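{- For any time complexity function $t$, $$\mathrm{IP}(\text{constant space},\ \infty\ \text{private random bits},\ \infty\ \text{public random bits},\ O(t(n))\ \text{time}) \subseteq \mathrm{IP}(\text{constant space},\ \text{linear private random bits},\ \text{linear public random bits},\ \text{linear time}).$$ The same inclusion holds when $\mathrm{IP}$ is replaced by $\mathrm{IP}_\varepsilon$ on both sides.
   Context: Interactive proof systems: a verifier is a probabilistic Turing machine with a read-only input tape containing $\rhd w\lhd$, a read-write work tape, and a communication cell shared with a prover. At each step the verifier may flip a private coin (outcome not seen by the prover) and/or a public coin (outcome automatically revealed to the prover), and may write a symbol to the communication cell; each time it writes to the cell, the prover overwrites it with a symbol that is an arbitrary function of $w$, the history of public coin outcomes, and the symbols written by the verifier so far. The prover does not see private coin outcomes, the verifier's state, work tape or head positions. The verifier halts upon entering its accept or reject state; it may also run forever. A verifier $V$ verifies $L$ with error $\varepsilon=\max(\varepsilon^+,\varepsilon^-)$ for some $\varepsilon^+,\varepsilon^-<1/2$ if (i) there is a prover $P$ such that for all $w\in L$, $V$ interacting with $P$ halts by accepting with probability at least $1-\varepsilon^+$, and (ii) for all provers $P^*$ and all $w\notin L$, $V$ interacting with $P^*$ halts by rejecting with probability at least $1-\varepsilon^-$. $\mathrm{IP}_\varepsilon(\ldots)$ denotes the class of languages verifiable with some error $\varepsilon<1/2$ by verifiers obeying the listed resource bounds; $\mathrm{IP}(\ldots)$ denotes the class of languages $L$ such that for every $\varepsilon>0$ there is a verifier obeying the listed bounds verifying $L$ with error at most $\varepsilon$. All bounds here are worst-case, as functions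 of the input length $n$: constant space means $O(1)$ work tape cells, linear means $O(n)$, and $\infty$ means unbounded. -}

module Defs where

open import Data.Nat as ℕ using (ℕ; zero; suc; _+_; _*_; _≤ᵇ_)
open import Data.Fin as Fin using (Fin)
open import Data.Fin.Properties using () renaming (_≟_ to _≟ᶠ_)
open import Data.Bool using (Bool; true; false; if_then_else_; _∧_)
open import Data.List using (List; []; _∷_; length; _++_; [_]; lookup)
open import Data.Maybe using (Maybe; just; nothing)
open import Data.Product using (Σ; ∃; _×_; _,_)
open import Data.Sum using (_⊎_)
open import Data.Rational as ℚ using (ℚ; 0ℚ; 1ℚ; ½)
open import Relation.Nullary using (¬_; yes; no)
open import Relation.Binary.PropositionalEquality using (_≡_; _≢_)

-- Symbols on the read-only input tape  ▷ w ◁  (input alphabet Fin s)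

data InSym (s : ℕ) : Set where
  ▷   : InSym s
  ◁   : InSym s
  sym : Fin s → InSym s

data Move : Set where
  left stay right : Move

-- Verifiers.
-- Work-tape alphabet Fin (suc nΓ) with blank symbol Fin.zero;
-- communication alphabet Fin (suc nΔ) with the cell initially Fin.zero.

record Action (nQ nΓ nΔ : ℕ) : Set where
  field
    next  : Fin nQ
    wsym  : Fin (suc nΓ)
    wmove : Move
    imove : Move
    comm  : Maybe (Fin (suc nΔ))

record Verifier (s : ℕ) : Set where
  field
    nQ nΓ nΔ : ℕ
    start accept reject : Fin nQ
    accept≢reject : accept ≢ reject
    usesPriv : Fin nQ → InSym s → Fin (suc nΓ) → Fin (suc nΔ) → Bool
    usesPub  : Fin nQ → InSym s → Fin (suc nΓ) → Fin (suc nΔ) → Bool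
    -- transition, given the private and public coin outcomes
    δ : Fin nQ → InSym s → Fin (suc nΓ) → Fin (suc nΔ) → Bool → Bool → Action nQ nΓ nΔ

-- A prover: the cell content it writes is a function of the input w, the history of
-- public coin outcomes, and the list of symbols written by the verifier so far.
Prover : (s nΔ : ℕ) → Set
Prover s nΔ = List (Fin s) → List Bool → List (Fin (suc nΔ)) → Fin (suc nΔ)

module _ {s : ℕ} (V : Verifier s) where
  open Verifier V

  record Config : Set where
    field
      state : Fin nQ
      ipos  : ℕ                    -- input head (0 = ▷, 1..n = w, n+1 = ◁)
      wpos  : ℕ
      tape  : ℕ → Fin (suc nΓ)
      cell  : Fin (suc nΔ)
      pubs  : List Bool
      sent  : List (Fin (suc nΔ))
      nPriv : ℕ
      nSteps : ℕ
  open Config public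

  initial : Config
  initial = record { state = start ; ipos = 0 ; wpos = 0 ; tape = λ _ → Fin.zero
                   ; cell = Fin.zero ; pubs = [] ; sent = [] ; nPriv = 0 ; nSteps = 0 }

  isAccept : Config → Bool
  isAccept c with state c ≟ᶠ accept
  ... | yes _ = true
  ... | no  _ = false

  isReject : Config → Bool
  isReject c with state c ≟ᶠ reject
  ... | yes _ = true
  ... | no  _ = false

  halted : Config → Bool
  halted c = if isAccept c then true else isReject c

  readIn : List (Fin s) → ℕ → InSym s
  readIn w zero = ▷
  readIn w (suc i) = go w i
    where
      go : List (Fin s) → ℕ → InSym s
      go [] _ = ◁
      go (a ∷ _) zero = sym a
      go (_ ∷ as) (suc j) = go as j

  moveIn : ℕ → ℕ → Move → ℕ
  moveIn n i left = ℕ.pred i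
  moveIn n i stay = i
  moveIn n i right = if i ≤ᵇ n then suc i else i

  moveW : ℕ → Move → ℕ
  moveW i left = ℕ.pred i
  moveW i stay = i
  moveW i right = suc i

  update : (ℕ → Fin (suc nΓ)) → ℕ → Fin (suc nΓ) → ℕ → Fin (suc nΓ)
  update f i b j = if j ℕ.≡ᵇ i then b else f j

  usesPrivC usesPubC : List (Fin s) → Config → Bool
  usesPrivC w c = usesPriv (state c) (readIn w (ipos c)) (tape c (wpos c)) (cell c)
  usesPubC  w c = usesPub  (state c) (readIn w (ipos c)) (tape c (wpos c)) (cell c)

  -- One step with coin outcomes p (private) and u (public); a coin that is not
  -- flipped has no effect (its outcome is replaced by false and not recorded).
  step : Prover s nΔ → List (Fin s) → Config → Bool → Bool → Config
  step P w c p u = record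
      { state = Action.next a
      ; ipos = moveIn (length w) (ipos c) (Action.imove a)
      ; wpos = moveW (wpos c) (Action.wmove a)
      ; tape = update (tape c) (wpos c) (Action.wsym a)
      ; cell = cell′
      ; pubs = pubs′
      ; sent = sent′
      ; nPriv = if up then suc (nPriv c) else nPriv c
      ; nSteps = suc (nSteps c) }
    where
      up = usesPrivC w c
      uu = usesPubC w c
      p′ = up ∧ p
      u′ = uu ∧ u
      pubs′ = if uu then pubs c ++ [ u ] else pubs c
      a = δ (state c) (readIn w (ipos c)) (tape c (wpos c)) (cell c) p′ u′
      sent′ : List (Fin (suc nΔ))
      sent′ with Action.comm a
      ... | nothing = sent c
      ... | just x  = sent c ++ [ x ]
      cell′ : Fin (suc nΔ)
      cell′ with Action.comm a
      ... | nothing = cell c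
      ... | just x  = P w pubs′ (sent c ++ [ x ])   -- prover immediately overwrites

  coinAvg : Bool → (Bool → ℚ) → ℚ
  coinAvg true  f = ½ ℚ.* (f true ℚ.+ f false)
  coinAvg false f = f false

  probWithin : (Config → Bool) → Prover s nΔ → List (Fin s) → ℕ → Config → ℚ
  probWithin goal P w fuel c with halted c
  probWithin goal P w fuel c | true = if goal c then 1ℚ else 0ℚ
  probWithin goal P w zero c | false = 0ℚ
  probWithin goal P w (suc f) c | false =
    coinAvg (usesPrivC w c) λ p → coinAvg (usesPubC w c) λ u →
      probWithin goal P w f (step P w c p u)

  -- "V with P on w halts by accepting (rejecting) with probability ≥ q":
  -- the probability is the limit of the nondecreasing sequence probWithin … fuel.
  AcceptsWithProb≥ : Prover s nΔ → List (Fin s) → ℚ → Set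
  AcceptsWithProb≥ P w q = ∃ λ fuel → q ℚ.≤ probWithin isAccept P w fuel initial

  RejectsWithProb≥ : Prover s nΔ → List (Fin s) → ℚ → Set
  RejectsWithProb≥ P w q = ∃ λ fuel → q ℚ.≤ probWithin isReject P w fuel initial

  data Reach (P : Prover s nΔ) (w : List (Fin s)) : Config → Set where
    init : Reach P w initial
    next : ∀ {c} → Reach P w c → halted c ≡ false → (p u : Bool) → Reach P w (step P w c p u)

  WorstCase : (Config → ℕ) → (ℕ → ℕ) → Set
  WorstCase measure f = ∃ λ k → ∀ (w : List (Fin s)) (P : Prover s nΔ) c →
    Reach P w c → measure c ℕ.≤ k * f (length w) + k

  Verifies : (List (Fin s) → Set) → ℚ → ℚ → Set
  Verifies L ε⁺ ε⁻ =
    (Σ (Prover s nΔ) λ P → ∀ w → L w → AcceptsWithProb≥ P w (1ℚ ℚ.- ε⁺)) ×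
    (∀ (P* : Prover s nΔ) w → ¬ L w → RejectsWithProb≥ P* w (1ℚ ℚ.- ε⁻))

-- Resource bounds: nothing = ∞ (unbounded), just f = O(f(n))

Bound : Set
Bound = Maybe (ℕ → ℕ)

constantB linearB : Bound
constantB = just (λ _ → 0)
linearB = just (λ n → n)

∞B : Bound
∞B = nothing

bigO : (ℕ → ℕ) → Bound
bigO t = just t

record Resources : Set where
  constructor res
  field
    space privBits pubBits time : Bound

Within : ∀ {s} → (V : Verifier s) → (Config V → ℕ) → Bound → Set
Within V m nothing = Data.Unit.⊤ where import Data.Unit
Within V m (just f) = WorstCase V m f

-- space = number of work-tape cells visited, i.e. (max work head position) + 1
Obeys : ∀ {s} → Verifier s → Resources → Set
Obeys V (res sp pr pu ti) =
  Within V (λ c → suc (wpos c)) sp ×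
  Within V nPriv pr ×
  Within V (λ c → length (pubs c)) pu ×
  Within V nSteps ti

IPε : Resources → (s : ℕ) → (List (Fin s) → Set) → Set
IPε R s L = Σ (Verifier s) λ V → Obeys V R ×
  ∃ λ ε⁺ → ∃ λ ε⁻ → ε⁺ ℚ.< ½ × ε⁻ ℚ.< ½ × Verifies V L ε⁺ ε⁻

IP : Resources → (s : ℕ) → (List (Fin s) → Set) → Set
IP R s L = ∀ (ε : ℚ) → 0ℚ ℚ.< ε → Σ (Verifier s) λ V → Obeys V R ×
  ∃ λ ε⁺ → ∃ λ ε⁻ → ε⁺ ℚ.< ½ × ε⁻ ℚ.< ½ × ε⁺ ℚ.≤ ε × ε⁻ ℚ.≤ ε × Verifies V L ε⁺ ε⁻

lhsRes : (ℕ → ℕ) → Resources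
lhsRes t = res constantB ∞B ∞B (bigO t)

rhsRes : Resources
rhsRes = res constantB linearB linearB linearB

-- Call two configurations equivalent if they agree on state, head positions, work tape and
-- communication cell.  With constant space there are only O(n) classes on an input of
-- length n.  If a run visited one class twice, the stretch in between could be replayed
-- arbitrarily often: the prover sees only the ever-growing history of sent symbols and
-- public coins, so a rewired prover can repeat its earlier replies and the replayed
-- configurations stay reachable.  A time bound, uniform over provers and coins, thus forces
-- every run to be shorter than the number of classes, i.e. linear time; the numbers of
-- private and public coins are bounded by the running time.
module Submission where

open import Data.Bool using (Bool; true; false; T; _∧_; _∨_)
open import Data.Unit using (tt)
open import Data.Fin as Fin using (Fin; toℕ; fromℕ<; combine; funToFin; finToFun)
open import Data.Fin.Properties
  using (pigeonhole; toℕ<n; toℕ-fromℕ<; fromℕ<-injective; combine-injective; finToFun-funToFin)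
  renaming (_≟_ to _≟ᶠ_)
open import Data.List using (List; length; _++_; [_])
open import Data.List.Properties using (length-++)
open import Data.Maybe using (just; nothing)
open import Data.Nat
open import Data.Nat.Properties
open import Data.Product using (Σ; ∃; _×_; _,_; proj₂)
open import Data.Sum using (inj₁; inj₂)
open import Function using (_∘_)
open import Relation.Binary.PropositionalEquality hiding ([_])
open import Relation.Nullary using (¬_; yes; no; ⌊_⌋; contradiction)
open import Defs hiding (sym)

length-snoc : ∀ {A : Set} (xs : List A) x → length (xs ++ [ x ]) ≡ suc (length xs)
length-snoc xs x = trans (length-++ xs) (+-comm (length xs) 1)

funToFin-injective : ∀ {m n} {f g : Fin m → Fin n} → funToFin f ≡ funToFin g → ∀ i → f i ≡ g i
funToFin-injective {f = f} {g} eq i = begin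
  f i                       ≡⟨ finToFun-funToFin f i ⟨
  finToFun (funToFin f) i   ≡⟨ cong (λ x → finToFun x i) eq ⟩
  finToFun (funToFin g) i   ≡⟨ finToFun-funToFin g i ⟩
  g i                       ∎
  where open ≡-Reasoning

classes-linear : ∀ a n → a * (2 + n) ≤ a * 2 * n + a * 2
classes-linear a n = begin
  a * (2 + n)        ≡⟨ *-distribˡ-+ a 2 n ⟩
  a * 2 + a * n      ≡⟨ +-comm (a * 2) (a * n) ⟩
  a * n + a * 2      ≤⟨ +-monoˡ-≤ (a * 2) (*-monoˡ-≤ n (m≤m*n a 2)) ⟩
  a * 2 * n + a * 2  ∎
  where open ≤-Reasoning

overrideAt : ∀ {s nΔ} → ℕ → Fin (suc nΔ) → Prover s nΔ → Prover s nΔ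
overrideAt n a P w ps st with length st ≟ n
... | yes _ = a
... | no  _ = P w ps st

overrideAt-hit : ∀ {s nΔ} n a (P : Prover s nΔ) {w ps st} →
  length st ≡ n → overrideAt n a P w ps st ≡ a
overrideAt-hit n a P {st = st} eq with length st ≟ n
... | yes _ = refl
... | no ne = contradiction eq ne

overrideAt-miss : ∀ {s nΔ} n a (P : Prover s nΔ) {w ps st} →
  length st ≢ n → overrideAt n a P w ps st ≡ P w ps st
overrideAt-miss n a P {st = st} ne with length st ≟ n
... | yes eq = contradiction eq ne
... | no  _  = refl

module _ {s : ℕ} (V : Verifier s) where
  open Verifier V

  haltedState : Fin nQ → Bool
  haltedState q = ⌊ q ≟ᶠ accept ⌋ ∨ ⌊ q ≟ᶠ reject ⌋

  halted-state : ∀ c → halted V c ≡ haltedState (state c)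
  halted-state c with state c ≟ᶠ accept
  ... | yes _ = refl
  ... | no  _ with state c ≟ᶠ reject
  ...   | yes _ = refl
  ...   | no  _ = refl

  halted-cong : ∀ {c d} → state c ≡ state d → halted V c ≡ halted V d
  halted-cong {c} {d} eq =
    trans (halted-state c) (trans (cong haltedState eq) (sym (halted-state d)))

  nPriv-≤-nSteps : ∀ {P w c} → Reach V P w c → nPriv c ≤ nSteps c
  nPriv-≤-nSteps init = z≤n
  nPriv-≤-nSteps {w = w} (next {c} r _ _ _) with usesPrivC V w c
  ... | true  = s≤s (nPriv-≤-nSteps r)
  ... | false = m≤n⇒m≤1+n (nPriv-≤-nSteps r)

  pubs-≤-nSteps : ∀ {P w c} → Reach V P w c → length (pubs c) ≤ nSteps c
  pubs-≤-nSteps init = z≤n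
  pubs-≤-nSteps {w = w} (next {c} r _ _ u) with usesPubC V w c
  ... | true  = ≤-trans (≤-reflexive (length-snoc (pubs c) u)) (s≤s (pubs-≤-nSteps r))
  ... | false = m≤n⇒m≤1+n (pubs-≤-nSteps r)

  worstCase-mono : ∀ {m m′ : Config V → ℕ} f →
    (∀ {P w c} → Reach V P w c → m c ≤ m′ c) → WorstCase V m′ f → WorstCase V m f
  worstCase-mono f m≤m′ (k , bound) = k , λ w P c r → ≤-trans (m≤m′ r) (bound w P c r)

  workConfigs : ℕ → ℕ
  workConfigs ks = nQ * ks * suc nΓ ^ ks * suc nΔ

  module _ (w : List (Fin s)) where

    Look : Set
    Look = Fin nQ × InSym s × Fin (suc nΓ) × Fin (suc nΔ)

    look : Config V → Look
    look c = state c , readIn V w (ipos c) , tape c (wpos c) , cell c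

    actionAt : Look → Bool → Bool → Action nQ nΓ nΔ
    actionAt (q , a , b , x) p u = δ q a b x (usesPriv q a b x ∧ p) (usesPub q a b x ∧ u)

    -- Coin and message histories and counters are ignored: the transition never reads them.
    record _≈_ (c d : Config V) : Set where
      field
        state≡ : state c ≡ state d
        ipos≡  : ipos c ≡ ipos d
        wpos≡  : wpos c ≡ wpos d
        tape≗  : ∀ j → tape c j ≡ tape d j
        cell≡  : cell c ≡ cell d
    open _≈_

    ≈-refl : ∀ {c} → c ≈ c
    ≈-refl = record
      { state≡ = refl ; ipos≡ = refl ; wpos≡ = refl ; tape≗ = λ _ → refl ; cell≡ = refl }

    ≈-sym : ∀ {c d} → c ≈ d → d ≈ c
    ≈-sym e = record
      { state≡ = sym (state≡ e) ; ipos≡ = sym (ipos≡ e) ; wpos≡ = sym (wpos≡ e)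
      ; tape≗ = sym ∘ tape≗ e ; cell≡ = sym (cell≡ e) }

    ≈-trans : ∀ {c d e} → c ≈ d → d ≈ e → c ≈ e
    ≈-trans a b = record
      { state≡ = trans (state≡ a) (state≡ b) ; ipos≡ = trans (ipos≡ a) (ipos≡ b)
      ; wpos≡ = trans (wpos≡ a) (wpos≡ b) ; tape≗ = λ j → trans (tape≗ a j) (tape≗ b j)
      ; cell≡ = trans (cell≡ a) (cell≡ b) }

    look-≈ : ∀ {c d} → c ≈ d → look c ≡ look d
    look-≈ {c} {d} e = cong₂ _,_ (state≡ e) (cong₂ _,_ (cong (readIn V w) (ipos≡ e))
      (cong₂ _,_ (trans (tape≗ e (wpos c)) (cong (tape d) (wpos≡ e))) (cell≡ e)))

    update-cong : ∀ {f g : ℕ → Fin (suc nΓ)} i b → (∀ j → f j ≡ g j) →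
      ∀ j → update V f i b j ≡ update V g i b j
    update-cong i b f≗g j with j ≡ᵇ i
    ... | true  = refl
    ... | false = f≗g j

    step-≈ : ∀ {P Q c d} p u → c ≈ d →
      cell (step V P w c p u) ≡ cell (step V Q w d p u) →
      step V P w c p u ≈ step V Q w d p u
    step-≈ {c = c} {d} p u c≈d cell-eq = record
      { state≡ = cong Action.next act≡
      ; ipos≡ = cong₂ (moveIn V (length w)) (ipos≡ c≈d) (cong Action.imove act≡)
      ; wpos≡ = cong₂ (moveW V) (wpos≡ c≈d) (cong Action.wmove act≡)
      ; tape≗ = λ j → trans (update-cong (wpos c) _ (tape≗ c≈d) j)
                      (cong₂ (λ i b → update V (tape d) i b j) (wpos≡ c≈d) (cong Action.wsym act≡))
      ; cell≡ = cell-eq }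
      where
      act≡ : actionAt (look c) p u ≡ actionAt (look d) p u
      act≡ = cong (λ v → actionAt v p u) (look-≈ c≈d)

    step-by-cell : ∀ P Q c p u → cell (step V Q w c p u) ≡ cell (step V P w c p u) →
      step V Q w c p u ≡ step V P w c p u
    step-by-cell P Q c p u eq = cong (λ x → record (step V P w c p u) { cell = x }) eq

    cell-silent : ∀ P c p u → Action.comm (actionAt (look c) p u) ≡ nothing →
      cell (step V P w c p u) ≡ cell c
    cell-silent P c p u eq rewrite eq = refl

    sent-grows : ∀ P c p u → length (sent c) ≤ length (sent (step V P w c p u))
    sent-grows P c p u with Action.comm (actionAt (look c) p u)
    ... | nothing = ≤-refl
    ... | just x  = ≤-trans (n≤1+n _) (≤-reflexive (sym (length-snoc (sent c) x)))

    AgreeUpTo : ℕ → Prover s nΔ → Prover s nΔ → Set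
    AgreeUpTo n P Q = ∀ ps st → length st ≤ n → P w ps st ≡ Q w ps st

    cell-agree : ∀ P Q c p u → AgreeUpTo (length (sent (step V P w c p u))) P Q →
      cell (step V Q w c p u) ≡ cell (step V P w c p u)
    cell-agree P Q c p u agree with Action.comm (actionAt (look c) p u)
    ... | nothing = refl
    ... | just x  = sym (agree _ _ ≤-refl)

    reach-agree : ∀ {P Q c} → Reach V P w c → AgreeUpTo (length (sent c)) P Q → Reach V Q w c
    reach-agree init _ = init
    reach-agree {P} {Q} (next {c} r h p u) agree =
      subst (Reach V Q w) (step-by-cell P Q c p u (cell-agree P Q c p u agree))
        (next (reach-agree r (λ ps st le → agree ps st (≤-trans le (sent-grows P c p u)))) h p u)

    record Attainable (m : ℕ) (e : Config V) : Set where
      constructor attained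
      field
        {prover} : Prover s nΔ
        {config} : Config V
        reach    : Reach V prover w config
        steps    : nSteps config ≡ m
        equiv    : config ≈ e

    attain-≈ : ∀ {m e e′} → Attainable m e → e ≈ e′ → Attainable m e′
    attain-≈ (attained r n c≈e) e≈e′ = attained r n (≈-trans c≈e e≈e′)

    -- The new prover answers like the old one on all histories seen so far and, at the
    -- next message, gives the reply that the step from e produced.
    attain-step : ∀ {m e} → Attainable m e → halted V e ≡ false → ∀ Q p u →
      Attainable (suc m) (step V Q w e p u)
    attain-step {e = e} (attained {P} {c} r refl c≈e) h Q p u =
      attained (next (reach-agree r agree) (trans (halted-cong (state≡ c≈e)) h) p u) refl
        (step-≈ p u c≈e cell-eq)
      where
      n = suc (length (sent c))
      P′ = overrideAt n (cell (step V Q w e p u)) P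
      agree : AgreeUpTo (length (sent c)) P P′
      agree ps st le = sym (overrideAt-miss n _ P λ eq → <-irrefl eq (s≤s le))
      comm≡ : Action.comm (actionAt (look c) p u) ≡ Action.comm (actionAt (look e) p u)
      comm≡ = cong (λ v → Action.comm (actionAt v p u)) (look-≈ c≈e)
      cell-eq : cell (step V P′ w c p u) ≡ cell (step V Q w e p u)
      cell-eq with Action.comm (actionAt (look c) p u) in silent
      ... | nothing = trans (cell≡ c≈e) (sym (cell-silent Q e p u (trans (sym comm≡) silent)))
      ... | just x  = overrideAt-hit n _ P {st = sent c ++ [ x ]} (length-snoc (sent c) x)

    Transition : Prover s nΔ → Config V → Config V → Set
    Transition P c d = halted V c ≡ false × ∃ λ p → ∃ λ u → d ≡ step V P w c p u

    Run : Prover s nΔ → (ℕ → Config V) → ℕ → Set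
    Run P ρ l = ∀ t → t < l → Transition P (ρ t) (ρ (suc t))

    run-≤ : ∀ {P ρ l l′} → l′ ≤ l → Run P ρ l → Run P ρ l′
    run-≤ l′≤l run t t<l′ = run t (<-≤-trans t<l′ l′≤l)

    run-shift : ∀ {P ρ} i k → Run P ρ (k + i) → Run P (λ t → ρ (t + i)) k
    run-shift i k run t t<k = run (t + i) (+-monoˡ-< i t<k)

    extend : (ℕ → Config V) → ℕ → Config V → ℕ → Config V
    extend ρ l d t with t ≤? l
    ... | yes _ = ρ t
    ... | no  _ = d

    extend-≤ : ∀ ρ {l} d {t} → t ≤ l → extend ρ l d t ≡ ρ t
    extend-≤ ρ {l} d {t} t≤l with t ≤? l
    ... | yes _  = refl
    ... | no t≰l = contradiction t≤l t≰l

    extend-suc : ∀ ρ l d → extend ρ l d (suc l) ≡ d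
    extend-suc ρ l d with suc l ≤? l
    ... | yes l<l = contradiction l<l (<-irrefl refl)
    ... | no  _   = refl

    run-extend : ∀ {P ρ l d} → Run P ρ l → Transition P (ρ l) d → Run P (extend ρ l d) (suc l)
    run-extend {P} {ρ} {l} {d} run last t t<1+l with m≤n⇒m<n∨m≡n (s≤s⁻¹ t<1+l)
    ... | inj₁ t<l  =
      subst₂ (Transition P) (sym (extend-≤ ρ d (<⇒≤ t<l))) (sym (extend-≤ ρ d t<l)) (run t t<l)
    ... | inj₂ refl =
      subst₂ (Transition P) (sym (extend-≤ ρ d ≤-refl)) (sym (extend-suc ρ l d)) last

    reach⇒run : ∀ {P c} → Reach V P w c →
      Σ (ℕ → Config V) λ ρ → ρ 0 ≡ initial V × ρ (nSteps c) ≡ c × Run P ρ (nSteps c)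
    reach⇒run init = (λ _ → initial V) , refl , refl , λ _ ()
    reach⇒run {P} (next {c} r h p u) with reach⇒run r
    ... | ρ , ρ₀ , ρₗ , run =
      extend ρ (nSteps c) d , trans (extend-≤ ρ {nSteps c} d z≤n) ρ₀ , extend-suc ρ (nSteps c) d ,
      run-extend run (subst (λ x → Transition P x d) (sym ρₗ) (h , p , u , refl))
      where d = step V P w c p u

    attain-run : ∀ {P ρ l m} → Run P ρ l → Attainable m (ρ 0) → Attainable (l + m) (ρ l)
    attain-run {l = zero}  _   a = a
    attain-run {P} {ρ} {suc l} run a with run l ≤-refl
    ... | h , p , u , eq =
      subst (Attainable _) (sym eq) (attain-step (attain-run (run-≤ (n≤1+n l) run) a) h P p u)

    attain-cycle : ∀ {P ρ l m} → Run P ρ l → ρ l ≈ ρ 0 → Attainable m (ρ 0) →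
      ∀ k → Attainable (k * l + m) (ρ 0)
    attain-cycle run loop a zero = a
    attain-cycle {ρ = ρ} {l} {m} run loop a (suc k) =
      subst (λ n → Attainable n (ρ 0)) (sym (+-assoc l (k * l) m))
        (attain-≈ (attain-run run (attain-cycle run loop a k)) loop)

    run-attainable : ∀ {P ρ l} → ρ 0 ≡ initial V → Run P ρ l → ∀ t → t ≤ l → Attainable t (ρ t)
    run-attainable {P} {ρ} ρ₀ run t t≤l =
      subst (λ n → Attainable n (ρ t)) (+-identityʳ t)
        (attain-run (run-≤ t≤l run) at-initial)
      where
      at-initial : Attainable 0 (ρ 0)
      at-initial = attained {prover = P} init refl (subst (initial V ≈_) (sym ρ₀) ≈-refl)

    TimeBounded : ℕ → Set
    TimeBounded B = ∀ {P c} → Reach V P w c → nSteps c ≤ B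

    no-attainable-cycle : ∀ {B P ρ l m} → TimeBounded B → Run P ρ l → 0 < l → ρ l ≈ ρ 0 →
      ¬ Attainable m (ρ 0)
    no-attainable-cycle {B} {l = l} {m} bounded run 0<l loop a = <-irrefl refl (begin-strict
      B              <⟨ n<1+n B ⟩
      suc B          ≤⟨ m≤m*n (suc B) l {{>-nonZero 0<l}} ⟩
      suc B * l      ≤⟨ m≤m+n _ m ⟩
      suc B * l + m  ≡⟨ steps ⟨
      nSteps config  ≤⟨ bounded reach ⟩
      B              ∎)
      where
      open Attainable (attain-cycle run loop a (suc B))
      open ≤-Reasoning

    time-bounded⇒steps< : ∀ {B M} → TimeBounded B →
      (code : ∀ {P c} → Reach V P w c → Fin M) →
      (∀ {P Q c d} (r : Reach V P w c) (r′ : Reach V Q w d) → code r ≡ code r′ → c ≈ d) →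
      ∀ {P c} → Reach V P w c → nSteps c < M
    time-bounded⇒steps< {M = M} bounded code code-injective {P} {c} r
      with nSteps c <? M | reach⇒run r
    ... | yes N<M | _ = N<M
    ... | no  N≮M | ρ , ρ₀ , _ , run = contradiction (pigeonhole (s≤s (≮⇒≥ N≮M)) class) no-repeat
      where
      N = nSteps c

      attain : (i : Fin (suc N)) → Attainable (toℕ i) (ρ (toℕ i))
      attain i = run-attainable ρ₀ run (toℕ i) (s≤s⁻¹ (toℕ<n i))

      class : Fin (suc N) → Fin M
      class = code ∘ Attainable.reach ∘ attain

      no-repeat : ¬ ∃ λ i → ∃ λ j → i Fin.< j × class i ≡ class j
      no-repeat (i , j , i<j , same) =
        no-attainable-cycle bounded cycle (m<n⇒0<n∸m i<j) loop (attain i)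
        where
        i≤j = <⇒≤ i<j
        cycle : Run P (λ t → ρ (t + toℕ i)) (toℕ j ∸ toℕ i)
        cycle = run-shift (toℕ i) _
          (run-≤ (≤-trans (≤-reflexive (m∸n+n≡m i≤j)) (s≤s⁻¹ (toℕ<n j))) run)
        loop : ρ ((toℕ j ∸ toℕ i) + toℕ i) ≈ ρ (toℕ i)
        loop = subst (λ n → ρ n ≈ ρ (toℕ i)) (sym (m∸n+n≡m i≤j))
          (≈-trans (≈-sym (Attainable.equiv (attain j)))
            (≈-trans (≈-sym (code-injective _ _ same)) (Attainable.equiv (attain i))))

    moveIn-≤ : ∀ i mv → i ≤ suc (length w) → moveIn V (length w) i mv ≤ suc (length w)
    moveIn-≤ i left  i≤ = ≤-trans pred[n]≤n i≤
    moveIn-≤ i stay  i≤ = i≤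
    moveIn-≤ i right i≤ with i ≤ᵇ length w in i≤n
    ... | true  = s≤s (≤ᵇ⇒≤ i (length w) (subst T (sym i≤n) tt))
    ... | false = i≤

    ipos-bounded : ∀ {P c} → Reach V P w c → ipos c < 2 + length w
    ipos-bounded init = z<s
    ipos-bounded {P} (next {c} r _ p u) =
      s≤s (moveIn-≤ (ipos c) (Action.imove (actionAt (look c) p u)) (s≤s⁻¹ (ipos-bounded r)))

    module _ (ks : ℕ) (space : ∀ {P c} → Reach V P w c → wpos c < ks) where

      tape-blank : ∀ {P c} → Reach V P w c → ∀ j → ks ≤ j → tape c j ≡ Fin.zero
      tape-blank init j _ = refl
      tape-blank (next {c} r _ _ _) j ks≤j with j ≡ᵇ wpos c in j≡
      ... | true  = contradiction (subst (_< ks) (sym j≡wpos) (space r)) (≤⇒≯ ks≤j)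
        where j≡wpos = ≡ᵇ⇒≡ j (wpos c) (subst T (sym j≡) tt)
      ... | false = tape-blank r j ks≤j

      code : ∀ {P c} → Reach V P w c → Fin (workConfigs ks * (2 + length w))
      code {c = c} r = combine (combine (combine (combine
        (state c) (fromℕ< (space r))) (funToFin {ks} (tape c ∘ toℕ))) (cell c))
        (fromℕ< (ipos-bounded r))

      code-injective : ∀ {P Q c d} (r : Reach V P w c) (r′ : Reach V Q w d) →
        code r ≡ code r′ → c ≈ d
      code-injective {c = c} {d} r r′ eq
        with rest₁ , ipos≡ ← combine-injective _ _ _ _ eq
        with rest₂ , cell≡ ← combine-injective _ _ _ _ rest₁
        with rest₃ , tape≡ ← combine-injective _ _ _ _ rest₂
        with state≡ , wpos≡ ← combine-injective _ _ _ _ rest₃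
        = record
          { state≡ = state≡
          ; ipos≡ = fromℕ<-injective _ _ (ipos-bounded r) (ipos-bounded r′) ipos≡
          ; wpos≡ = fromℕ<-injective _ _ (space r) (space r′) wpos≡
          ; tape≗ = tape-agree
          ; cell≡ = cell≡ }
        where
        tape-agree : ∀ j → tape c j ≡ tape d j
        tape-agree j with j <? ks
        ... | yes j<ks = subst (λ i → tape c i ≡ tape d i) (toℕ-fromℕ< j<ks)
          (funToFin-injective {f = tape c ∘ toℕ} {tape d ∘ toℕ} tape≡ (fromℕ< j<ks))
        ... | no  j≮ks = trans (tape-blank r j (≮⇒≥ j≮ks)) (sym (tape-blank r′ j (≮⇒≥ j≮ks)))

  constant-space⇒linear-time : WorstCase V (λ c → suc (wpos c)) (λ _ → 0) →
    (∀ w → ∃ (TimeBounded w)) → WorstCase V nSteps (λ n → n)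
  constant-space⇒linear-time (ks , space) time = a * 2 , bound
    where
    a = workConfigs ks
    bound : ∀ w P c → Reach V P w c → nSteps c ≤ a * 2 * length w + a * 2
    bound w P c r = ≤-trans
      (<⇒≤ (time-bounded⇒steps< w (proj₂ (time w))
              (code w ks space′) (code-injective w ks space′) r))
      (classes-linear a (length w))
      where
      space′ : ∀ {P c} → Reach V P w c → wpos c < ks
      space′ {P} {c} r = subst (suc (wpos c) ≤_) (cong (_+ ks) (*-zeroʳ ks)) (space w P c r)

  obeys-lhsRes⇒rhsRes : ∀ t → Obeys V (lhsRes t) → Obeys V rhsRes
  obeys-lhsRes⇒rhsRes t (space , _ , _ , kt , time) =
    space , worstCase-mono (λ n → n) nPriv-≤-nSteps linear ,
    worstCase-mono (λ n → n) pubs-≤-nSteps linear , linear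
    where
    linear : WorstCase V nSteps (λ n → n)
    linear = constant-space⇒linear-time space
      (λ w → kt * t (length w) + kt , λ {P} {c} → time w P c)

theorem3 : (t : ℕ → ℕ) (s : ℕ) (L : List (Fin s) → Set) →
    (IP (lhsRes t) s L → IP rhsRes s L) × (IPε (lhsRes t) s L → IPε rhsRes s L)
theorem3 t s L = ip , ipε
  where
  ip : IP (lhsRes t) s L → IP rhsRes s L
  ip verifiers ε ε>0 with V , obeys , errors ← verifiers ε ε>0 =
    V , obeys-lhsRes⇒rhsRes V t obeys , errors
  ipε : IPε (lhsRes t) s L → IPε rhsRes s L
  ipε (V , obeys , errors) = V , obeys-lhsRes⇒rhsRes V t obeys , errors
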